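{- If $n$ and $r$ are integers with $2 \le n \leq r$, then ${\rm sg}(P_r\,\square\, P_n)\leq \lceil 2\sqrt{n}\, \rceil$.
   Context: $P_m$ denotes the path with vertex set $\{1,\dots,m\}$ and edges $\{i,i+1\}$. The Cartesian product $G\,\square\, H$ has vertex set $V(G)\times V(H)$, with $(g,h)$ adjacent to $(g',h')$ iff either $g=g'$ and $hh'\in E(H)$, or $h=h'$ and $gg'\in E(G)$. For a graph $G=(V,E)$ and $S\subseteq V$, for each pair $\{x,y\}\subseteq S$ with $x\neq y$ let $\widetilde{P}(x,y)$ be a selected fixed shortest $x,y$-path, and let $\widetilde{I}(S)=\{\widetilde{P}(x,y): x,y\in S\}$. $S$ is a strong geodetic set if for some such choice of geodesics, every vertex of $G$ lies on some path of $\widetilde{I}(S)$. The strong geodetic number ${\rm sg}(G)$ is the minimum cardinality of a strong geodetic set of $G$. -}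

module Defs where

open import Level using (0ℓ)
open import Data.Nat using (ℕ; suc; _+_; _*_; _≤_; _<_)
open import Data.Fin using (Fin; toℕ)
open import Data.Product using (Σ; ∃; _×_; _,_)
open import Data.Sum using (_⊎_)
open import Data.List using (List; []; _∷_; length; lookup)
open import Data.List.Relation.Unary.Unique.Propositional using (Unique)
open import Data.List.Membership.Propositional using (_∈_)
open import Relation.Binary.PropositionalEquality using (_≡_)

record Graph : Set₁ where
  field
    V   : Set
    _~_ : V → V → Set
open Graph public

-- The path P_m, with vertex set Fin m (= {0,…,m-1}, a relabelling of {1,…,m})
-- and edges {i, i+1}.
PathGraph : ℕ → Graph
PathGraph m = record
  { V   = Fin m
  ; _~_ = λ i j → (toℕ j ≡ suc (toℕ i)) ⊎ (toℕ i ≡ suc (toℕ j)) }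

_□_ : Graph → Graph → Graph
G □ H = record
  { V   = V G × V H
  ; _~_ = λ { (g , h) (g' , h') →
              (g ≡ g' × _~_ H h h') ⊎ (h ≡ h' × _~_ G g g') } }

data Walk (G : Graph) : V G → V G → List (V G) → Set where
  here : ∀ {x} → Walk G x x (x ∷ [])
  step : ∀ {x z y l} → _~_ G x z → Walk G z y l → Walk G x y (x ∷ l)

IsPath : (G : Graph) → V G → V G → List (V G) → Set
IsPath G x y l = Walk G x y l × Unique l

IsGeodesic : (G : Graph) → V G → V G → List (V G) → Set
IsGeodesic G x y l =
  IsPath G x y l × (∀ l' → IsPath G x y l' → length l ≤ length l')

-- S (a duplicate-free list of vertices) is a strong geodetic set of G:
-- one fixed geodesic is selected for every unordered pair {x,y} of distinct
-- vertices of S (pairs indexed by positions i < j in S), and every vertex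
-- of G lies on one of the selected geodesics.
IsStrongGeodeticSet : (G : Graph) → List (V G) → Set
IsStrongGeodeticSet G S =
  Unique S ×
  Σ ((i j : Fin (length S)) → toℕ i < toℕ j → List (V G)) λ geo →
    ((i j : Fin (length S)) (p : toℕ i < toℕ j) →
       IsGeodesic G (lookup S i) (lookup S j) (geo i j p)) ×
    ((v : V G) → ∃ λ i → ∃ λ j → Σ (toℕ i < toℕ j) λ p → v ∈ geo i j p)

-- sg(G) ≤ k  (sg is the minimum size of a strong geodetic set).
SgAtMost : Graph → ℕ → Set
SgAtMost G k = Σ (List (V G)) λ S → IsStrongGeodeticSet G S × length S ≤ k

-- k = ⌈2√n⌉, i.e. k is the least natural number with 4n ≤ k².
IsCeil2Sqrt : ℕ → ℕ → Set
IsCeil2Sqrt n k = (4 * n ≤ k * k) × (∀ j → 4 * n ≤ j * j → k ≤ j)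

module Submission where

-- Let a = ⌊k/2⌋ and b = ⌈k/2⌉, so that a + b = k and n ≤ ab, and put c = n − b. Take the vertices in
-- rows 0, …, a−1 of the first column and in rows c, …, c+b−1 of the last column. Listed in this order
-- they form a chain for the coordinatewise order, and between two comparable vertices every monotone
-- staircase (up, across along one row, up) is a geodesic, so each pair may cross the grid along any
-- row between its endpoints. Letting the pair (p, q) of a left and a right vertex cross along row
-- min(pb, c) + q reaches every row: the rows below c as pb + q by division by b, and the rows c + q
-- with p = a − 1, since c ≤ (a−1)b.

open import Defs
open import Data.Empty using (⊥-elim)
open import Data.Fin using (Fin; toℕ; fromℕ; fromℕ<; cast) renaming (zero to fzero; suc to fsuc)
open import Data.Fin.Properties
  using (toℕ<n; toℕ-fromℕ; toℕ-fromℕ<; toℕ-cast; cast-involutive; toℕ-injective)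
open import Data.List using (List; []; _∷_; _++_; drop; map; length; lookup; tabulate)
open import Data.List.Membership.Propositional using (_∈_)
open import Data.List.Membership.Propositional.Properties using (∈-map⁺; ∈-++⁺ˡ; ∈-++⁺ʳ)
open import Data.List.Properties using (length-++; length-drop; length-map; length-tabulate; lookup-tabulate)
import Data.List.Relation.Unary.All as All
open import Data.List.Relation.Unary.AllPairs using ([]; _∷_)
open import Data.List.Relation.Unary.Any using (here; there)
open import Data.List.Relation.Unary.Unique.Propositional using (Unique)
open import Data.List.Relation.Unary.Unique.Propositional.Properties using (tabulate⁺)
open import Data.Nat using (ℕ; zero; suc; _+_; _*_; _∸_; _≤_; _<_; z≤n; s≤s; s≤s⁻¹; ∣_-_∣; _⊓_; _⊔_; _<?_;
                            ⌊_/2⌋; ⌈_/2⌉; NonZero; >-nonZero⁻¹)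
open import Data.Nat.DivMod using (_/_; _%_; m≡m%n+[m/n]*n; m%n<n; m/n≤m; m/n*n≤m; m<n*o⇒m/o<n)
open import Data.Nat.Properties
open import Data.Nat.Tactic.RingSolver using (solve-∀)
open import Data.Product using (Σ; ∃; ∃₂; _×_; _,_; proj₁; proj₂)
open import Data.Sum using (_⊎_; inj₁; inj₂)
open import Function using (_∘_)
open import Relation.Binary.Definitions using (tri<; tri≈; tri>)
open import Relation.Binary.PropositionalEquality
open import Relation.Nullary using (yes; no)

module _ {G : Graph} where

  private variable
    x y z v : V G
    l m : List (V G)

  _++ʷ_ : Walk G x y l → Walk G y z m → Walk G x z (l ++ drop 1 m)
  here     ++ʷ here      = here
  here     ++ʷ step e w  = step e w
  step e w ++ʷ w′        = step e (w ++ʷ w′)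

  end∈ : Walk G x y l → y ∈ l
  end∈ here       = here refl
  end∈ (step _ w) = there (end∈ w)

  ∈-++ʷ⁺ʳ : Walk G x y l → Walk G y z m → v ∈ m → v ∈ l ++ drop 1 m
  ∈-++ʷ⁺ʳ w here         (here refl) = ∈-++⁺ˡ (end∈ w)
  ∈-++ʷ⁺ʳ w (step _ _)   (here refl) = ∈-++⁺ˡ (end∈ w)
  ∈-++ʷ⁺ʳ {l = l} w (step _ _) (there v∈) = ∈-++⁺ʳ l v∈

  ∈⇒suffix : Walk G x y l → v ∈ l → ∃ λ m → Walk G v y m × length m ≤ length l
  ∈⇒suffix here       (here refl) = _ , here , ≤-refl
  ∈⇒suffix (step e w) (here refl) = _ , step e w , ≤-refl
  ∈⇒suffix (step _ w) (there v∈) with ∈⇒suffix w v∈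
  ... | m , w′ , m≤l = m , w′ , m≤n⇒m≤1+n m≤l

module _ {G H : Graph} (φ : V G → V H) (φ-hom : ∀ {x y} → _~_ G x y → _~_ H (φ x) (φ y)) where

  mapWalk : ∀ {x y l} → Walk G x y l → Walk H (φ x) (φ y) (map φ l)
  mapWalk here       = here
  mapWalk (step e w) = step (φ-hom e) (mapWalk w)

module TightWalks {G : Graph} (d : V G → V G → ℕ) (d-refl : ∀ x → d x x ≡ 0)
                 (d-step : ∀ {x z} y → _~_ G x z → d x y ≤ suc (d z y)) where

  private variable
    x y : V G
    l : List (V G)

  d<length : Walk G x y l → d x y < length l
  d<length {y = y} here = s≤s (≤-reflexive (d-refl y))
  d<length {y = y} (step e w) = s≤s (≤-trans (d-step y e) (d<length w))

  tight⇒unique : Walk G x y l → length l ≡ suc (d x y) → Unique l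
  tight⇒unique here _ = All.[] ∷ []
  tight⇒unique {x} {y} (step {z = z} {l = l} e w) tight =
    All.tabulate x∉l ∷ tight⇒unique w tight′
    where
      l≡d : length l ≡ d x y
      l≡d = suc-injective tight
      tight′ : length l ≡ suc (d z y)
      tight′ = ≤-antisym (≤-trans (≤-reflexive l≡d) (d-step y e)) (d<length w)
      x∉l : ∀ {v} → v ∈ l → x ≢ v
      x∉l v∈ refl with ∈⇒suffix w v∈
      ... | _ , w′ , m≤l = <⇒≱ (≤-trans (d<length w′) m≤l) (≤-reflexive l≡d)

  tight⇒geodesic : Walk G x y l → length l ≡ suc (d x y) → IsGeodesic G x y l
  tight⇒geodesic w tight =
    (w , tight⇒unique w tight) , λ _ (w′ , _) → ≤-trans (≤-reflexive tight) (d<length w′)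

suc-~ : ∀ {m} {i j : Fin m} → _~_ (PathGraph m) i j → _~_ (PathGraph (suc m)) (fsuc i) (fsuc j)
suc-~ (inj₁ eq) = inj₁ (cong suc eq)
suc-~ (inj₂ eq) = inj₂ (cong suc eq)

[0⋯_] : ∀ {m} → Fin m → List (Fin m)
[0⋯ fzero  ] = fzero ∷ []
[0⋯ fsuc j ] = fzero ∷ map fsuc [0⋯ j ]

-- Junk value [] when j < i.
[_⋯_] : ∀ {m} → Fin m → Fin m → List (Fin m)
[ fzero  ⋯ j      ] = [0⋯ j ]
[ fsuc i ⋯ fzero  ] = []
[ fsuc i ⋯ fsuc j ] = map fsuc [ i ⋯ j ]

[0⋯]-walk : ∀ {m} (j : Fin (suc m)) → Walk (PathGraph (suc m)) fzero j [0⋯ j ]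
[0⋯]-walk         fzero    = here
[0⋯]-walk {zero}  (fsuc ())
[0⋯]-walk {suc _} (fsuc j) = step (inj₁ refl) (mapWalk fsuc suc-~ ([0⋯]-walk j))

[⋯]-walk : ∀ {m} {i j : Fin m} → toℕ i ≤ toℕ j → Walk (PathGraph m) i j [ i ⋯ j ]
[⋯]-walk {i = fzero}  {j}      _         = [0⋯]-walk j
[⋯]-walk {i = fsuc i} {fsuc j} (s≤s i≤j) = mapWalk fsuc suc-~ ([⋯]-walk i≤j)

length-[0⋯] : ∀ {m} (j : Fin m) → length [0⋯ j ] ≡ suc (toℕ j)
length-[0⋯] fzero    = refl
length-[0⋯] (fsuc j) = cong suc (trans (length-map fsuc [0⋯ j ]) (length-[0⋯] j))

length-[⋯] : ∀ {m} {i j : Fin m} → toℕ i ≤ toℕ j → length [ i ⋯ j ] ≡ suc (toℕ j ∸ toℕ i)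
length-[⋯] {i = fzero}  {j}      _         = length-[0⋯] j
length-[⋯] {i = fsuc i} {fsuc j} (s≤s i≤j) = trans (length-map fsuc [ i ⋯ j ]) (length-[⋯] i≤j)

∈-[0⋯] : ∀ {m} {c j : Fin m} → toℕ c ≤ toℕ j → c ∈ [0⋯ j ]
∈-[0⋯] {c = fzero}  {fzero}  _         = here refl
∈-[0⋯] {c = fzero}  {fsuc j} _         = here refl
∈-[0⋯] {c = fsuc c} {fsuc j} (s≤s c≤j) = there (∈-map⁺ fsuc (∈-[0⋯] c≤j))

∈-[⋯] : ∀ {m} {i c j : Fin m} → toℕ i ≤ toℕ c → toℕ c ≤ toℕ j → c ∈ [ i ⋯ j ]
∈-[⋯] {i = fzero}                    _         c≤j       = ∈-[0⋯] c≤j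
∈-[⋯] {i = fsuc i} {fsuc c} {fsuc j} (s≤s i≤c) (s≤s c≤j) = ∈-map⁺ fsuc (∈-[⋯] i≤c c≤j)

∣-∣-step : ∀ {m n} w → (n ≡ suc m) ⊎ (m ≡ suc n) → ∣ m - w ∣ ≤ suc ∣ n - w ∣
∣-∣-step {m} {n} w m~n =
  ≤-trans (∣-∣-triangle m n w) (+-monoˡ-≤ ∣ n - w ∣ (≤-reflexive (∣m-n∣≡1 m~n)))
  where
    ∣m-n∣≡1 : (n ≡ suc m) ⊎ (m ≡ suc n) → ∣ m - n ∣ ≡ 1
    ∣m-n∣≡1 (inj₁ refl) = trans (m≤n⇒∣m-n∣≡n∸m (n≤1+n m)) (m+n∸n≡m 1 m)
    ∣m-n∣≡1 (inj₂ refl) = trans (m≤n⇒∣n-m∣≡n∸m (n≤1+n n)) (m+n∸n≡m 1 n)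

∸-+-split : ∀ {m n o} → m ≤ n → n ≤ o → (o ∸ n) + (n ∸ m) ≡ o ∸ m
∸-+-split {m} {n} {o} m≤n n≤o = begin
  (o ∸ n) + (n ∸ m)  ≡⟨ +-∸-assoc (o ∸ n) m≤n ⟨
  (o ∸ n) + n ∸ m    ≡⟨ cong (_∸ m) (m∸n+n≡m n≤o) ⟩
  o ∸ m              ∎
  where open ≡-Reasoning

length-++ʷ : ∀ {A : Set} (l m : List A) {d₁ d₂} → length l ≡ suc d₁ → length m ≡ suc d₂ →
             length (l ++ drop 1 m) ≡ suc (d₁ + d₂)
length-++ʷ l m l≡ m≡ =
  trans (length-++ l) (cong₂ _+_ l≡ (trans (length-drop 1 m) (cong (_∸ 1) m≡)))

clamp : ℕ → ℕ → ℕ → ℕ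
clamp lo t hi = (lo ⊔ t) ⊓ hi

clamp-≤ : ∀ lo t hi → clamp lo t hi ≤ hi
clamp-≤ lo t hi = m⊓n≤n (lo ⊔ t) hi

≤-clamp : ∀ {lo hi} t → lo ≤ hi → lo ≤ clamp lo t hi
≤-clamp {lo} t lo≤hi = ⊓-glb (m≤m⊔n lo t) lo≤hi

clamp-id : ∀ {lo t hi} → lo ≤ t → t ≤ hi → clamp lo t hi ≡ t
clamp-id {hi = hi} lo≤t t≤hi = trans (cong (_⊓ hi) (m≤n⇒m⊔n≡n lo≤t)) (m≤n⇒m⊓n≡m t≤hi)

tabulate-isStrongGeodeticSet : ∀ {G k} (f : Fin k → V G) (geo : Fin k → Fin k → List (V G)) →
  (∀ {i j} → f i ≡ f j → i ≡ j) →
  (∀ {i j} → toℕ i < toℕ j → IsGeodesic G (f i) (f j) (geo i j)) →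
  (∀ v → ∃₂ λ i j → toℕ i < toℕ j × v ∈ geo i j) →
  IsStrongGeodeticSet G (tabulate f)
tabulate-isStrongGeodeticSet {G} f geo f-injective geo-isGeodesic geo-covers =
  tabulate⁺ f-injective ,
  (λ i j _ → geo (↓ i) (↓ j)) ,
  (λ i j i<j → subst₂ (λ x y → IsGeodesic G x y (geo (↓ i) (↓ j)))
                 (sym (lookup-↓ i)) (sym (lookup-↓ j)) (geo-isGeodesic (↓-< i<j))) ,
  covers
  where
    ↓ : Fin (length (tabulate f)) → Fin _
    ↓ = cast (length-tabulate f)
    ↑ : Fin _ → Fin (length (tabulate f))
    ↑ = cast (sym (length-tabulate f))
    ↓↑ : ∀ i → ↓ (↑ i) ≡ i
    ↓↑ = cast-involutive (length-tabulate f) (sym (length-tabulate f))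
    ↑↓ : ∀ i → ↑ (↓ i) ≡ i
    ↑↓ = cast-involutive (sym (length-tabulate f)) (length-tabulate f)
    lookup-↓ : ∀ i → lookup (tabulate f) i ≡ f (↓ i)
    lookup-↓ i = trans (cong (lookup (tabulate f)) (sym (↑↓ i))) (lookup-tabulate f (↓ i))
    ↓-< : ∀ {i j} → toℕ i < toℕ j → toℕ (↓ i) < toℕ (↓ j)
    ↓-< {i} {j} = subst₂ _<_ (sym (toℕ-cast _ i)) (sym (toℕ-cast _ j))
    covers : ∀ v → ∃ λ i → ∃ λ j → Σ (toℕ i < toℕ j) λ _ → v ∈ geo (↓ i) (↓ j)
    covers v with geo-covers v
    ... | i , j , i<j , v∈ = ↑ i , ↑ j , subst₂ _<_ (sym (toℕ-cast _ i)) (sym (toℕ-cast _ j)) i<j ,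
                             subst₂ (λ i j → v ∈ geo i j) (sym (↓↑ i)) (sym (↓↑ j)) v∈

module Grid (R N : ℕ) where

  G : Graph
  G = PathGraph R □ PathGraph N

  manhattan : V G → V G → ℕ
  manhattan (g , h) (g′ , h′) = ∣ toℕ g - toℕ g′ ∣ + ∣ toℕ h - toℕ h′ ∣

  manhattan-refl : ∀ x → manhattan x x ≡ 0
  manhattan-refl (g , h) = cong₂ _+_ (∣n-n∣≡0 (toℕ g)) (∣n-n∣≡0 (toℕ h))

  manhattan-step : ∀ {x z} y → _~_ G x z → manhattan x y ≤ suc (manhattan z y)
  manhattan-step {g , _} (g′ , h′) (inj₁ (refl , h~)) =
    ≤-trans (+-monoʳ-≤ ∣ toℕ g - toℕ g′ ∣ (∣-∣-step (toℕ h′) h~)) (≤-reflexive (+-suc _ _))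
  manhattan-step {_ , h} (g′ , h′) (inj₂ (refl , g~)) =
    +-monoˡ-≤ ∣ toℕ h - toℕ h′ ∣ (∣-∣-step (toℕ g′) g~)

  open TightWalks manhattan manhattan-refl (λ {x} {z} → manhattan-step {x} {z}) using (tight⇒geodesic)

  column-walk : ∀ g {h h′ l} → Walk (PathGraph N) h h′ l → Walk G (g , h) (g , h′) (map (g ,_) l)
  column-walk g = mapWalk (g ,_) (λ e → inj₁ (refl , e))

  row-walk : ∀ h {g g′ l} → Walk (PathGraph R) g g′ l → Walk G (g , h) (g′ , h) (map (_, h) l)
  row-walk h = mapWalk (_, h) (λ e → inj₂ (refl , e))

  staircase : V G → V G → Fin N → List (V G)
  staircase (g₁ , h₁) (g₂ , h₂) h =
    map (g₁ ,_) [ h₁ ⋯ h ] ++ drop 1 (map (_, h) [ g₁ ⋯ g₂ ] ++ drop 1 (map (g₂ ,_) [ h ⋯ h₂ ]))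

  module _ {g₁ g₂ : Fin R} {h₁ h h₂ : Fin N}
           (g₁≤g₂ : toℕ g₁ ≤ toℕ g₂) (h₁≤h : toℕ h₁ ≤ toℕ h) (h≤h₂ : toℕ h ≤ toℕ h₂) where

    private
      lower  = map (g₁ ,_) [ h₁ ⋯ h ]
      middle = map (_, h) [ g₁ ⋯ g₂ ]
      upper  = map (g₂ ,_) [ h ⋯ h₂ ]
      up₁    = column-walk g₁ ([⋯]-walk h₁≤h)
      across = row-walk h ([⋯]-walk g₁≤g₂)
      up₂    = column-walk g₂ ([⋯]-walk h≤h₂)

    staircase-walk : Walk G (g₁ , h₁) (g₂ , h₂) (staircase (g₁ , h₁) (g₂ , h₂) h)
    staircase-walk = up₁ ++ʷ (across ++ʷ up₂)

    length-staircase : length (staircase (g₁ , h₁) (g₂ , h₂) h) ≡ suc (manhattan (g₁ , h₁) (g₂ , h₂))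
    length-staircase = begin
      length (lower ++ drop 1 (middle ++ drop 1 upper))
        ≡⟨ length-++ʷ lower (middle ++ drop 1 upper) (|map| [ h₁ ⋯ h ] (length-[⋯] h₁≤h))
             (length-++ʷ middle upper (|map| [ g₁ ⋯ g₂ ] (length-[⋯] g₁≤g₂))
                                      (|map| [ h ⋯ h₂ ] (length-[⋯] h≤h₂))) ⟩
      suc ((toℕ h ∸ toℕ h₁) + ((toℕ g₂ ∸ toℕ g₁) + (toℕ h₂ ∸ toℕ h)))
        ≡⟨ cong suc (+-comm (toℕ h ∸ toℕ h₁) _) ⟩
      suc ((toℕ g₂ ∸ toℕ g₁) + (toℕ h₂ ∸ toℕ h) + (toℕ h ∸ toℕ h₁))
        ≡⟨ cong suc (+-assoc (toℕ g₂ ∸ toℕ g₁) _ _) ⟩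
      suc ((toℕ g₂ ∸ toℕ g₁) + ((toℕ h₂ ∸ toℕ h) + (toℕ h ∸ toℕ h₁)))
        ≡⟨ cong (λ d → suc ((toℕ g₂ ∸ toℕ g₁) + d)) (∸-+-split h₁≤h h≤h₂) ⟩
      suc ((toℕ g₂ ∸ toℕ g₁) + (toℕ h₂ ∸ toℕ h₁))
        ≡⟨ cong suc (cong₂ _+_ (m≤n⇒∣m-n∣≡n∸m g₁≤g₂) (m≤n⇒∣m-n∣≡n∸m (≤-trans h₁≤h h≤h₂))) ⟨
      suc (manhattan (g₁ , h₁) (g₂ , h₂))
        ∎
      where
        open ≡-Reasoning
        |map| : ∀ {A B : Set} {f : A → B} l {d} → length l ≡ suc d → length (map f l) ≡ suc d
        |map| {f = f} l = trans (length-map f l)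

    staircase-isGeodesic : IsGeodesic G (g₁ , h₁) (g₂ , h₂) (staircase (g₁ , h₁) (g₂ , h₂) h)
    staircase-isGeodesic = tight⇒geodesic staircase-walk length-staircase

    ∈-staircase : ∀ {g} → toℕ g₁ ≤ toℕ g → toℕ g ≤ toℕ g₂ → (g , h) ∈ staircase (g₁ , h₁) (g₂ , h₂) h
    ∈-staircase g₁≤g g≤g₂ =
      ∈-++ʷ⁺ʳ up₁ (across ++ʷ up₂) (∈-++⁺ˡ (∈-map⁺ (_, h) (∈-[⋯] g₁≤g g≤g₂)))

  _≼_ : V G → V G → Set
  (g , h) ≼ (g′ , h′) = toℕ g ≤ toℕ g′ × toℕ h ≤ toℕ h′

  ≼-trans : ∀ {x y z} → x ≼ y → y ≼ z → x ≼ z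
  ≼-trans (g≤ , h≤) (g≤′ , h≤′) = ≤-trans g≤ g≤′ , ≤-trans h≤ h≤′

  _≺_ : V G → V G → Set
  x ≺ y = x ≼ y × x ≢ y

  clampRow : Fin N → ℕ → Fin N → Fin N
  clampRow lo t hi = fromℕ< (≤-<-trans (clamp-≤ (toℕ lo) t (toℕ hi)) (toℕ<n hi))

  toℕ-clampRow : ∀ lo t hi → toℕ (clampRow lo t hi) ≡ clamp (toℕ lo) t (toℕ hi)
  toℕ-clampRow lo t hi = toℕ-fromℕ< _

  -- Clamping ρ into the rows of the two endpoints makes every staircase legal, so ρ only has to be
  -- right on the pairs that do the covering.
  chain-isStrongGeodeticSet : ∀ {k} (f : Fin k → V G) (ρ : Fin k → Fin k → ℕ) →
    (∀ {i j} → toℕ i < toℕ j → f i ≺ f j) →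
    (∀ v → ∃₂ λ i j → toℕ i < toℕ j × f i ≼ v × v ≼ f j × ρ i j ≡ toℕ (proj₂ v)) →
    IsStrongGeodeticSet G (tabulate f)
  chain-isStrongGeodeticSet f ρ f-increasing ρ-covers =
    tabulate-isStrongGeodeticSet f geo f-injective geo-isGeodesic geo-covers
    where
      through : ∀ i j → Fin N
      through i j = clampRow (proj₂ (f i)) (ρ i j) (proj₂ (f j))

      geo : ∀ i j → List (V G)
      geo i j = staircase (f i) (f j) (through i j)

      through-between : ∀ {i j} → f i ≼ f j →
                        toℕ (proj₂ (f i)) ≤ toℕ (through i j) × toℕ (through i j) ≤ toℕ (proj₂ (f j))
      through-between {i} {j} (_ , hᵢ≤hⱼ) =
        ≤-trans (≤-clamp (ρ i j) hᵢ≤hⱼ) (≤-reflexive (sym (toℕ-clampRow _ (ρ i j) _))) ,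
        ≤-trans (≤-reflexive (toℕ-clampRow _ (ρ i j) _)) (clamp-≤ _ (ρ i j) _)

      f-injective : ∀ {i j} → f i ≡ f j → i ≡ j
      f-injective {i} {j} eq with <-cmp (toℕ i) (toℕ j)
      ... | tri< i<j _ _ = ⊥-elim (proj₂ (f-increasing i<j) eq)
      ... | tri≈ _ i≡j _ = toℕ-injective i≡j
      ... | tri> _ _ j<i = ⊥-elim (proj₂ (f-increasing j<i) (sym eq))

      geo-isGeodesic : ∀ {i j} → toℕ i < toℕ j → IsGeodesic G (f i) (f j) (geo i j)
      geo-isGeodesic i<j with f-increasing i<j
      ... | fᵢ≼fⱼ@(gᵢ≤gⱼ , _) , _ =
        staircase-isGeodesic gᵢ≤gⱼ (proj₁ (through-between fᵢ≼fⱼ)) (proj₂ (through-between fᵢ≼fⱼ))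

      geo-covers : ∀ v → ∃₂ λ i j → toℕ i < toℕ j × v ∈ geo i j
      geo-covers v with ρ-covers v
      ... | i , j , i<j , fᵢ≼v@(gᵢ≤g , hᵢ≤h) , v≼fⱼ@(g≤gⱼ , h≤hⱼ) , ρ≡h =
        i , j , i<j , subst (λ h → (proj₁ v , h) ∈ geo i j) through≡h
                        (∈-staircase (≤-trans gᵢ≤g g≤gⱼ) (proj₁ bounds) (proj₂ bounds) gᵢ≤g g≤gⱼ)
        where
          bounds = through-between (≼-trans fᵢ≼v v≼fⱼ)
          through≡h : through i j ≡ proj₂ v
          through≡h = toℕ-injective (begin
            toℕ (through i j)                      ≡⟨ toℕ-clampRow _ (ρ i j) _ ⟩
            clamp (toℕ (proj₂ (f i))) (ρ i j) _    ≡⟨ clamp-id (subst (_ ≤_) (sym ρ≡h) hᵢ≤h)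
                                                                (subst (_≤ _) (sym ρ≡h) h≤hⱼ) ⟩
            ρ i j                                  ≡⟨ ρ≡h ⟩
            toℕ (proj₂ v)                          ∎)
            where open ≡-Reasoning

rows-covered : ∀ {a b c} .{{_ : NonZero b}} → 1 ≤ a → a ≤ suc c → c + b ≤ a * b →
               ∀ t → t < c + b → ∃₂ λ p q → p < a × q < b × p ≤ t × t ≡ p * b ⊓ c + q
rows-covered {suc a} {b} {c} _ a≤1+c c+b≤ab t t<c+b with t <? c
... | yes t<c = t / b , t % b , t/b<1+a , m%n<n t b , m/n≤m t b , t≡
  where
    open ≡-Reasoning
    t/b<1+a : t / b < suc a
    t/b<1+a = m<n*o⇒m/o<n (<-≤-trans t<c (≤-trans (m≤m+n c b) c+b≤ab))
    t≡ : t ≡ t / b * b ⊓ c + t % b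
    t≡ = begin
      t                        ≡⟨ m≡m%n+[m/n]*n t b ⟩
      t % b + t / b * b        ≡⟨ +-comm (t % b) _ ⟩
      t / b * b + t % b        ≡⟨ cong (_+ t % b) (m≤n⇒m⊓n≡m (<⇒≤ (≤-<-trans (m/n*n≤m t b) t<c))) ⟨
      t / b * b ⊓ c + t % b    ∎
... | no t≮c = a , t ∸ c , ≤-refl , m<n+o⇒m∸n<o t c t<c+b , ≤-trans (s≤s⁻¹ a≤1+c) c≤t , t≡
  where
    c≤t : c ≤ t
    c≤t = ≮⇒≥ t≮c
    c≤ab : c ≤ a * b
    c≤ab = +-cancelʳ-≤ b c (a * b) (≤-trans c+b≤ab (≤-reflexive (+-comm b (a * b))))
    t≡ : t ≡ a * b ⊓ c + (t ∸ c)
    t≡ = sym (trans (cong (_+ (t ∸ c)) (m≥n⇒m⊓n≡n c≤ab)) (m+[n∸m]≡n c≤t))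

module TwoColumns (r a b n : ℕ) .{{_ : NonZero b}}
                  (1≤a : 1 ≤ a) (a+b≤1+n : a + b ≤ suc n) (n≤ab : n ≤ a * b) where

  open Grid (suc (suc r)) n public

  c : ℕ
  c = n ∸ b

  c+b≡n : c + b ≡ n
  c+b≡n = m∸n+n≡m (s≤s⁻¹ (≤-trans (+-monoˡ-≤ b 1≤a) a+b≤1+n))

  a≤1+c : a ≤ suc c
  a≤1+c = +-cancelʳ-≤ b a (suc c) (≤-trans a+b≤1+n (≤-reflexive (cong suc (sym c+b≡n))))

  data Side (p : ℕ) : Set where
    left  : p < a → Side p
    right : a ≤ p → Side p

  side : ∀ p → Side p
  side p with p <? a
  ... | yes p<a = left p<a
  ... | no  p≮a = right (≮⇒≥ p≮a)

  column : ∀ {p} → Side p → Fin (suc (suc r))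
  column (left _)  = fzero
  column (right _) = fromℕ (suc r)

  height : ∀ {p} → Side p → ℕ
  height {p} (left _)  = p
  height {p} (right _) = c + (p ∸ a)

  height<n : ∀ {p} → p < a + b → (s : Side p) → height s < n
  height<n p<a+b s = subst (height s <_) c+b≡n (bound s)
    where
      bound : (s : Side _) → height s < c + b
      bound (left p<a)  = ≤-<-trans (s≤s⁻¹ (≤-trans p<a a≤1+c)) (m<m+n c (>-nonZero⁻¹ b))
      bound (right a≤p) = +-monoʳ-< c (m<n+o⇒m∸n<o _ a p<a+b)

  vertex : Fin (a + b) → V G
  vertex i = column s , fromℕ< (height<n (toℕ<n i) s)
    where s = side (toℕ i)

  toℕ-row : ∀ i → toℕ (proj₂ (vertex i)) ≡ height (side (toℕ i))
  toℕ-row i = toℕ-fromℕ< _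

  sides-increasing : ∀ {p q} → p < q → (s : Side p) (s′ : Side q) →
    toℕ (column s) ≤ toℕ (column s′) × height s ≤ height s′ ×
    (column s ≢ column s′ ⊎ height s < height s′)
  sides-increasing p<q (left _)    (left _)    = ≤-refl , <⇒≤ p<q , inj₂ p<q
  sides-increasing p<q (left p<a)  (right _)   =
    z≤n , ≤-trans (s≤s⁻¹ (≤-trans p<a a≤1+c)) (m≤m+n c _) , inj₁ (λ ())
  sides-increasing p<q (right a≤p) (left q<a)  = ⊥-elim (<⇒≱ (<-trans p<q q<a) a≤p)
  sides-increasing p<q (right a≤p) (right _)   =
    ≤-refl , +-monoʳ-≤ c (∸-monoˡ-≤ a (<⇒≤ p<q)) , inj₂ (+-monoʳ-< c (∸-monoˡ-< p<q a≤p))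

  vertex-increasing : ∀ {i j} → toℕ i < toℕ j → vertex i ≺ vertex j
  vertex-increasing {i} {j} i<j with sides-increasing i<j (side (toℕ i)) (side (toℕ j))
  ... | col≤ , height≤ , strict =
    (col≤ , subst₂ _≤_ (sym (toℕ-row i)) (sym (toℕ-row j)) height≤) , distinct strict
    where
      distinct : _ → vertex i ≢ vertex j
      distinct (inj₁ col≢) eq = col≢ (cong proj₁ eq)
      distinct (inj₂ height<) eq =
        <-irrefl (trans (sym (toℕ-row i)) (trans (cong (toℕ ∘ proj₂) eq) (toℕ-row j))) height<

  left-vertex-≼ : ∀ {i g t} → toℕ i < a → toℕ i ≤ toℕ t → vertex i ≼ (g , t)
  left-vertex-≼ {i} i<a i≤t with side (toℕ i)
  ... | left _     = z≤n , subst (_≤ _) (sym (toℕ-fromℕ< _)) i≤t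
  ... | right a≤i  = ⊥-elim (<⇒≱ i<a a≤i)

  ≼-right-vertex : ∀ {j g t} → a ≤ toℕ j → toℕ t ≤ c + (toℕ j ∸ a) → (g , t) ≼ vertex j
  ≼-right-vertex {j} {g} a≤j t≤ with side (toℕ j)
  ... | left j<a   = ⊥-elim (<⇒≱ j<a a≤j)
  ... | right _    = subst (toℕ g ≤_) (sym (toℕ-fromℕ (suc r))) (s≤s⁻¹ (toℕ<n g)) ,
                     subst (_ ≤_) (sym (toℕ-fromℕ< _)) t≤

  ρ : Fin (a + b) → Fin (a + b) → ℕ
  ρ i j = toℕ i * b ⊓ c + (toℕ j ∸ a)

  vertices-cover : ∀ v → ∃₂ λ i j →
    toℕ i < toℕ j × vertex i ≼ v × v ≼ vertex j × ρ i j ≡ toℕ (proj₂ v)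
  vertices-cover (g , t)
    with rows-covered 1≤a a≤1+c (subst (_≤ a * b) (sym c+b≡n) n≤ab)
                      (toℕ t) (subst (toℕ t <_) (sym c+b≡n) (toℕ<n t))
  ... | p , q , p<a , q<b , p≤t , t≡ =
    i , j , <-≤-trans i<a a≤j , left-vertex-≼ i<a (subst (_≤ toℕ t) (sym toℕ-i) p≤t) ,
    ≼-right-vertex a≤j t≤ , ρ≡
    where
      i j : Fin (a + b)
      i = fromℕ< (≤-trans p<a (m≤m+n a b))
      j = fromℕ< (+-monoʳ-< a q<b)
      toℕ-i : toℕ i ≡ p
      toℕ-i = toℕ-fromℕ< _
      i<a : toℕ i < a
      i<a = subst (_< a) (sym toℕ-i) p<a
      a≤j : a ≤ toℕ j
      a≤j = subst (a ≤_) (sym (toℕ-fromℕ< _)) (m≤m+n a q)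
      ρ≡ : ρ i j ≡ toℕ t
      ρ≡ = begin
        toℕ i * b ⊓ c + (toℕ j ∸ a)   ≡⟨ cong₂ (λ x y → x * b ⊓ c + (y ∸ a)) toℕ-i (toℕ-fromℕ< _) ⟩
        p * b ⊓ c + (a + q ∸ a)       ≡⟨ cong (p * b ⊓ c +_) (m+n∸m≡n a q) ⟩
        p * b ⊓ c + q                 ≡⟨ t≡ ⟨
        toℕ t                         ∎
        where open ≡-Reasoning
      t≤ : toℕ t ≤ c + (toℕ j ∸ a)
      t≤ = ≤-trans (≤-reflexive (sym ρ≡)) (+-monoˡ-≤ (toℕ j ∸ a) (m⊓n≤n _ c))

sg-grid≤ : ∀ {r n} a b → 2 ≤ r → 1 ≤ a → 1 ≤ b → a + b ≤ suc n → n ≤ a * b →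
           SgAtMost (PathGraph r □ PathGraph n) (a + b)
sg-grid≤ {suc (suc r)} {n} a (suc b) (s≤s (s≤s z≤n)) 1≤a (s≤s z≤n) a+b≤1+n n≤ab =
  tabulate vertex ,
  chain-isStrongGeodeticSet vertex ρ vertex-increasing vertices-cover ,
  ≤-reflexive (length-tabulate vertex)
  where open TwoColumns r a (suc b) n 1≤a a+b≤1+n n≤ab

[2+m]*[2+m]≡m*m+4*[1+m] : ∀ m → suc (suc m) * suc (suc m) ≡ m * m + 4 * suc m
[2+m]*[2+m]≡m*m+4*[1+m] = solve-∀

k*k≤1+4*⌊k/2⌋*⌈k/2⌉ : ∀ k → k * k ≤ suc (4 * (⌊ k /2⌋ * ⌈ k /2⌉))
k*k≤1+4*⌊k/2⌋*⌈k/2⌉ zero          = z≤n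
k*k≤1+4*⌊k/2⌋*⌈k/2⌉ (suc zero)    = ≤-refl
k*k≤1+4*⌊k/2⌋*⌈k/2⌉ (suc (suc k)) = begin
  suc (suc k) * suc (suc k)                   ≡⟨ [2+m]*[2+m]≡m*m+4*[1+m] k ⟩
  k * k + 4 * suc k                           ≤⟨ +-mono-≤ (k*k≤1+4*⌊k/2⌋*⌈k/2⌉ k) (≤-reflexive 4[1+k]≡4[1+A+B]) ⟩
  suc (4 * (A * B)) + 4 * suc (A + B)         ≡⟨ expand A B ⟨
  suc (4 * (suc A * suc B))                   ∎
  where
    open ≤-Reasoning
    A = ⌊ k /2⌋
    B = ⌈ k /2⌉
    4[1+k]≡4[1+A+B] : 4 * suc k ≡ 4 * suc (A + B)
    4[1+k]≡4[1+A+B] = cong (λ x → 4 * suc x) (sym (⌊n/2⌋+⌈n/2⌉≡n k))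
    expand : ∀ A B → suc (4 * (suc A * suc B)) ≡ suc (4 * (A * B)) + 4 * suc (A + B)
    expand = solve-∀

4*m≤1+4*n⇒m≤n : ∀ {m n} → 4 * m ≤ suc (4 * n) → m ≤ n
4*m≤1+4*n⇒m≤n {m} {n} 4m≤1+4n = s≤s⁻¹ (*-cancelˡ-< 4 m (suc n) (begin-strict
  4 * m        ≤⟨ 4m≤1+4n ⟩
  suc (4 * n)  <⟨ s≤s (s≤s (m≤n+m (4 * n) 2)) ⟩
  4 + 4 * n    ≡⟨ *-suc 4 n ⟨
  4 * suc n    ∎))
  where open ≤-Reasoning

IsCeil2Sqrt⇒2≤k : ∀ {n k} → 2 ≤ n → IsCeil2Sqrt n k → 2 ≤ k
IsCeil2Sqrt⇒2≤k {k = zero}        (s≤s (s≤s _)) (() , _)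
IsCeil2Sqrt⇒2≤k {k = suc zero}    (s≤s (s≤s _)) (s≤s () , _)
IsCeil2Sqrt⇒2≤k {k = suc (suc _)} _             _ = s≤s (s≤s z≤n)

IsCeil2Sqrt⇒k≤1+n : ∀ {n k} → 1 ≤ n → IsCeil2Sqrt n k → k ≤ suc n
IsCeil2Sqrt⇒k≤1+n {suc m} _ (_ , least) =
  least (suc (suc m))
        (≤-trans (m≤n+m (4 * suc m) (m * m)) (≤-reflexive (sym ([2+m]*[2+m]≡m*m+4*[1+m] m))))

IsCeil2Sqrt⇒n≤⌊k/2⌋*⌈k/2⌉ : ∀ {n k} → IsCeil2Sqrt n k → n ≤ ⌊ k /2⌋ * ⌈ k /2⌉
IsCeil2Sqrt⇒n≤⌊k/2⌋*⌈k/2⌉ {k = k} (4n≤k*k , _) =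
  4*m≤1+4*n⇒m≤n (≤-trans 4n≤k*k (k*k≤1+4*⌊k/2⌋*⌈k/2⌉ k))

lemma3p1 : (n r k : ℕ) → 2 ≤ n → n ≤ r → IsCeil2Sqrt n k →
    SgAtMost (PathGraph r □ PathGraph n) k
lemma3p1 n r k 2≤n n≤r ceil =
  subst (SgAtMost (PathGraph r □ PathGraph n)) a+b≡k
    (sg-grid≤ ⌊ k /2⌋ ⌈ k /2⌉ (≤-trans 2≤n n≤r) 1≤a (≤-trans 1≤a (⌊n/2⌋≤⌈n/2⌉ k))
      (subst (_≤ suc n) (sym a+b≡k) (IsCeil2Sqrt⇒k≤1+n (≤-trans (s≤s z≤n) 2≤n) ceil))
      (IsCeil2Sqrt⇒n≤⌊k/2⌋*⌈k/2⌉ ceil))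
  where
    a+b≡k : ⌊ k /2⌋ + ⌈ k /2⌉ ≡ k
    a+b≡k = ⌊n/2⌋+⌈n/2⌉≡n k
    1≤a : 1 ≤ ⌊ k /2⌋
    1≤a = ⌊n/2⌋-mono (IsCeil2Sqrt⇒2≤k 2≤n ceil)
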